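{- Let $\alpha,\beta\in\mathbb{R}$. Given a sequence $x=(x_n)_{n\in\mathbb{N}}$, define $y=(y_n)_{n\in\mathbb{N}}$ by \[ y_n=\sum_{k=1}^n\binom{\alpha n+\beta k-1}{k-1}(k-1)!\,B_{n,k}(x_1,x_2,\dots). \] Then for every $n\ge1$ and every $\lambda\in\mathbb{C}$, \[ \sum_{k=1}^n\lambda^{k-1}B_{n,k}(y_1,y_2,\dots)=\sum_{k=1}^n\binom{\alpha n+\beta k-1+\lambda}{k-1}(k-1)!\,B_{n,k}(x_1,x_2,\dots). \]
   Context: For $k\ge 0$, the partial Bell polynomials $B_{n,k}(z_1,z_2,\dots)$ are defined by $\frac{1}{k!}\big(\sum_{j\ge1} z_j \frac{t^j}{j!}\big)^k=\sum_{n\ge k}B_{n,k}(z_1,z_2,\dots)\frac{t^n}{n!}$. For complex $z$ and integer $m\ge0$, $\binom{z}{m}m!=z(z-1)\cdots(z-m+1)$ (equal to $1$ when $m=0$). -}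

module Defs where

open import Level using (Level)
open import Algebra.Bundles using (CommutativeRing)
open import Data.Nat using (ℕ; zero; suc; _∸_)
open import Data.Nat.Combinatorics using (_C_)

module BellDefs {c ℓ : Level} (R : CommutativeRing c ℓ) where
  open CommutativeRing R

  ι : ℕ → Carrier
  ι zero    = 0#
  ι (suc n) = 1# + ι n

  sumTo : ℕ → (ℕ → Carrier) → Carrier
  sumTo zero    f = 0#
  sumTo (suc n) f = sumTo n f + f n

  prodTo : ℕ → (ℕ → Carrier) → Carrier
  prodTo zero    f = 1#
  prodTo (suc n) f = prodTo n f * f n

  pow : Carrier → ℕ → Carrier
  pow a m = prodTo m (λ _ → a)

  -- falling factorial:  binom(a, m) * m! = a (a-1) ... (a-m+1)   (= 1 for m = 0)
  fallFact : Carrier → ℕ → Carrier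
  fallFact a m = prodTo m (λ i → a - ι i)

  -- Partial Bell polynomials B_{n,k}(z_1, z_2, ...), where the sequence is
  -- given as z : ℕ → R with z j = z_j (the value z 0 is never used).  Defined by the standard recurrence
  -- B_{0,0}=1, B_{n,0}=0 (n≥1), B_{0,k}=0 (k≥1),
  -- B_{n+1,k+1} = Σ_{i=0}^{n} C(n,i) z_{i+1} B_{n-i,k},
  -- which is the coefficient extraction of d/dt (f^{k+1}/(k+1)!) = f' f^k/k!
  -- for f = Σ_j z_j t^j/j!.
  Bell : (ℕ → Carrier) → ℕ → ℕ → Carrier
  Bell z zero    zero    = 1#
  Bell z (suc n) zero    = 0#
  Bell z zero    (suc k) = 0#
  Bell z (suc n) (suc k) =
    sumTo (suc n) (λ i → ι (n C i) * (z (suc i) * Bell z (n ∸ i) k))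

  yseq : Carrier → Carrier → (ℕ → Carrier) → ℕ → Carrier
  yseq α β x n =
    sumTo n (λ j → fallFact (α * ι n + β * ι (suc j) - 1#) j * Bell x n (suc j))

module Submission where

-- Sequences ℕ → R are read as exponential generating functions (EGFs): the
-- product is the binomial convolution (A ⋆ B) n = Σᵢ C(n,i) Aᵢ Bₙ₋ᵢ and the
-- derivative is the shift ∂.  For a parameter c put (↓ = falling factorial)
--   ψ_c(n) = Σ_k (c + αn + βk)↓k B_{n,k}(x),
--   q_c(n) = Σ_{k≥1} (αn + βk − 1 + c)↓(k−1) B_{n,k}(x),   g_c = 1 + c·q_c,
-- so q_λ is the right-hand side of the theorem and q_0 = y.  The core is the
-- exponential law g_a ⋆ g_b = g_{a+b} (jointly with g_a ⋆ ψ_b = ψ_{a+b}), proved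
-- by strong induction from a formula for q_c' and a splitting of ψ_c, which rest
-- on the Euler-type identities k B_{n,k} = (x ⋆ B_{·,k−1})ₙ, n B_{n,k} = (θx ⋆ B_{·,k−1})ₙ.
-- The law yields q_λ' = y' (1 + λ q_λ); the left-hand side, the EGF of (e^{λY} − 1)/λ,
-- solves the same equation for any y, and its solutions are unique.

open import Defs
open import Level using (Level; _⊔_)
open import Algebra.Bundles using (CommutativeRing)
open import Data.Nat using (ℕ; zero; suc; _≤_; _<_; _∸_; z≤n; s≤s)
open import Data.Nat.Properties using (≤-refl; ≤-trans; m∸n≤m; n∸n≡0; m+[n∸m]≡n; +-∸-assoc; m≤n⇒m<n∨m≡n; n≤1+n)
open import Data.Nat.Combinatorics using (_C_; nCn≡1; nCk+nC[k+1]≡[n+1]C[k+1])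
open import Data.Nat.Combinatorics.Specification using (k>n⇒nCk≡0)
open import Data.Nat.Induction using (<-rec)
open import Data.Product using (_×_; _,_; proj₂)
open import Data.Sum using (inj₁; inj₂)
import Data.Nat as ℕ
import Relation.Binary.PropositionalEquality as P

module BellIdentity {c ℓ : Level} (R : CommutativeRing c ℓ) where
  open CommutativeRing R hiding (zero)
  open BellDefs R
  open import Algebra.Solver.Ring.NaturalCoefficients.Default commutativeSemiring
  open import Relation.Binary.Reasoning.Setoid setoid
  open import Algebra.Properties.AbelianGroup +-abelianGroup using (⁻¹-∙-comm)
  open import Algebra.Properties.Group +-group using (ε⁻¹≈ε)

  Seq : Set c
  Seq = ℕ → Carrier

  sumTo-cong< : ∀ n {f g : Seq} → (∀ i → i < n → f i ≈ g i) → sumTo n f ≈ sumTo n g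
  sumTo-cong< zero    eq = refl
  sumTo-cong< (suc n) eq = +-cong (sumTo-cong< n (λ i i<n → eq i (≤-trans i<n (n≤1+n n)))) (eq n ≤-refl)

  sumTo-cong : ∀ n {f g : Seq} → (∀ i → f i ≈ g i) → sumTo n f ≈ sumTo n g
  sumTo-cong n eq = sumTo-cong< n (λ i _ → eq i)

  sumTo-zero : ∀ n {f : Seq} → (∀ i → i < n → f i ≈ 0#) → sumTo n f ≈ 0#
  sumTo-zero zero    vanish = refl
  sumTo-zero (suc n) vanish =
    trans (+-cong (sumTo-zero n (λ i i<n → vanish i (≤-trans i<n (n≤1+n n)))) (vanish n ≤-refl)) (+-identityʳ 0#)

  sumTo-+ : ∀ n (f g : Seq) → sumTo n (λ i → f i + g i) ≈ sumTo n f + sumTo n g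
  sumTo-+ zero    f g = sym (+-identityʳ 0#)
  sumTo-+ (suc n) f g = begin
    sumTo n (λ i → f i + g i) + (f n + g n) ≈⟨ +-cong (sumTo-+ n f g) refl ⟩
    (sumTo n f + sumTo n g) + (f n + g n)
      ≈⟨ solve 4 (λ a b c d → (a :+ b) :+ (c :+ d) := (a :+ c) :+ (b :+ d)) refl (sumTo n f) (sumTo n g) (f n) (g n) ⟩
    (sumTo n f + f n) + (sumTo n g + g n) ∎

  sumTo-*ˡ : ∀ n a (f : Seq) → a * sumTo n f ≈ sumTo n (λ i → a * f i)
  sumTo-*ˡ zero    a f = zeroʳ a
  sumTo-*ˡ (suc n) a f = trans (distribˡ a (sumTo n f) (f n)) (+-cong (sumTo-*ˡ n a f) refl)

  sumTo-peel : ∀ n (f : Seq) → sumTo (suc n) f ≈ f 0 + sumTo n (λ i → f (suc i))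
  sumTo-peel zero    f = trans (+-identityˡ _) (sym (+-identityʳ _))
  sumTo-peel (suc n) f = trans (+-cong (sumTo-peel n f) refl) (+-assoc _ _ _)

  sumTo-swap : ∀ m p (h : ℕ → ℕ → Carrier) →
               sumTo m (λ j → sumTo p (λ i → h i j)) ≈ sumTo p (λ i → sumTo m (λ j → h i j))
  sumTo-swap zero    p h = sym (sumTo-zero p (λ _ _ → refl))
  sumTo-swap (suc m) p h = begin
    sumTo m (λ j → sumTo p (λ i → h i j)) + sumTo p (λ i → h i m) ≈⟨ +-cong (sumTo-swap m p h) refl ⟩
    sumTo p (λ i → sumTo m (λ j → h i j)) + sumTo p (λ i → h i m) ≈⟨ sumTo-+ p _ _ ⟨
    sumTo p (λ i → sumTo m (λ j → h i j) + h i m) ∎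

  -- The double-sum exchange in the weighted shape produced by convolutions.
  sumTo-swap-weighted : ∀ m p (a b u : Seq) (h : ℕ → ℕ → Carrier) →
    sumTo m (λ j → a j * sumTo p (λ i → b i * (u i * h i j)))
      ≈ sumTo p (λ i → b i * (u i * sumTo m (λ j → a j * h i j)))
  sumTo-swap-weighted m p a b u h = begin
    sumTo m (λ j → a j * sumTo p (λ i → b i * (u i * h i j))) ≈⟨ sumTo-cong m (λ j → sumTo-*ˡ p (a j) _) ⟩
    sumTo m (λ j → sumTo p (λ i → a j * (b i * (u i * h i j)))) ≈⟨ sumTo-swap m p _ ⟩
    sumTo p (λ i → sumTo m (λ j → a j * (b i * (u i * h i j))))
      ≈⟨ sumTo-cong p (λ i → sumTo-cong m (λ j → solve 4 (λ a b u h → a :* (b :* (u :* h)) := b :* (u :* (a :* h))) refl (a j) (b i) (u i) (h i j))) ⟩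
    sumTo p (λ i → sumTo m (λ j → b i * (u i * (a j * h i j)))) ≈⟨ sumTo-cong p (λ i → sumTo-*ˡ m (b i) _) ⟨
    sumTo p (λ i → b i * sumTo m (λ j → u i * (a j * h i j))) ≈⟨ sumTo-cong p (λ i → *-cong refl (sumTo-*ˡ m (u i) _)) ⟨
    sumTo p (λ i → b i * (u i * sumTo m (λ j → a j * h i j))) ∎

  sumTo-truncate : ∀ m p {f : Seq} → p ≤ m → (∀ i → p ≤ i → i < m → f i ≈ 0#) → sumTo m f ≈ sumTo p f
  sumTo-truncate zero    .zero z≤n    vanish = refl
  sumTo-truncate (suc m) p p≤m+1 vanish with m≤n⇒m<n∨m≡n p≤m+1
  ... | inj₂ P.refl     = refl
  ... | inj₁ (s≤s p≤m) =
    trans (+-cong (sumTo-truncate m p p≤m (λ i p≤i i<m → vanish i p≤i (≤-trans i<m (n≤1+n m)))) (vanish m p≤m ≤-refl))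
          (+-identityʳ _)

  ι-+ : ∀ m n → ι (m ℕ.+ n) ≈ ι m + ι n
  ι-+ zero    n = sym (+-identityˡ _)
  ι-+ (suc m) n = trans (+-cong refl (ι-+ m n)) (sym (+-assoc _ _ _))

  ι-∸ : ∀ {i n} → i ≤ n → ι n ≈ ι i + ι (n ∸ i)
  ι-∸ {i} i≤n = trans (reflexive (P.cong ι (P.sym (m+[n∸m]≡n i≤n)))) (ι-+ i _)

  ∸-suc< : ∀ {n i} → i < n → n ∸ suc i < n
  ∸-suc< {n} {i} i<n = P.subst (_≤ n) (+-∸-assoc 1 i<n) (m∸n≤m n i)

  ι-pascal : ∀ n j → ι (suc n C suc j) ≈ ι (n C j) + ι (n C suc j)
  ι-pascal n j = trans (reflexive (P.cong ι (P.sym (nCk+nC[k+1]≡[n+1]C[k+1] n j)))) (ι-+ (n C j) _)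

  -- Calculus of exponential generating functions.

  -- Derivative d/dt and Euler operator t·d/dt on EGF coefficients.
  ∂ : Seq → Seq
  ∂ A n = A (suc n)

  θ : Seq → Seq
  θ A n = ι n * A n

  𝟙 : Seq
  𝟙 zero    = 1#
  𝟙 (suc n) = 0#

  -- Binomial convolution whose second factor may depend on the summation index:
  -- the coefficients of Σᵢ Xᵢ tⁱ/i! · Yᵢ(t).
  dconv : Seq → (ℕ → Seq) → Seq
  dconv X Y n = sumTo (suc n) (λ i → ι (n C i) * (X i * Y i (n ∸ i)))

  infixl 7 _⋆_
  _⋆_ : Seq → Seq → Seq
  A ⋆ B = dconv A (λ _ → B)

  dconv-cong : ∀ n (X X' : Seq) (Y Y' : ℕ → Seq) → (∀ i → i ≤ n → X i * Y i (n ∸ i) ≈ X' i * Y' i (n ∸ i)) →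
               dconv X Y n ≈ dconv X' Y' n
  dconv-cong n X X' Y Y' eq = sumTo-cong< (suc n) (λ { i (s≤s i≤n) → *-cong refl (eq i i≤n) })

  dconv-congʳ : ∀ n X (Y Y' : ℕ → Seq) → (∀ i → i ≤ n → Y i (n ∸ i) ≈ Y' i (n ∸ i)) → dconv X Y n ≈ dconv X Y' n
  dconv-congʳ n X Y Y' eq = dconv-cong n X X Y Y' (λ i i≤n → *-cong refl (eq i i≤n))

  ⋆-congˡ : ∀ n {A A' B} → (∀ m → m ≤ n → A m ≈ A' m) → (A ⋆ B) n ≈ (A' ⋆ B) n
  ⋆-congˡ n {A} {A'} {B} eq = dconv-cong n A A' (λ _ → B) (λ _ → B) (λ i i≤n → *-cong (eq i i≤n) refl)

  ⋆-congʳ : ∀ n {A B B'} → (∀ m → m ≤ n → B m ≈ B' m) → (A ⋆ B) n ≈ (A ⋆ B') n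
  ⋆-congʳ n {A} {B} {B'} eq = dconv-congʳ n A (λ _ → B) (λ _ → B') (λ i _ → eq _ (m∸n≤m n i))

  dconv-+ˡ : ∀ n X X' Y → dconv (λ i → X i + X' i) Y n ≈ dconv X Y n + dconv X' Y n
  dconv-+ˡ n X X' Y = trans (sumTo-cong (suc n) (λ i → trans (*-cong refl (distribʳ _ _ _)) (distribˡ _ _ _))) (sumTo-+ (suc n) _ _)

  dconv-+ʳ : ∀ n X Y Z → dconv X (λ i m → Y i m + Z i m) n ≈ dconv X Y n + dconv X Z n
  dconv-+ʳ n X Y Z = trans (sumTo-cong (suc n) (λ i → trans (*-cong refl (distribˡ _ _ _)) (distribˡ _ _ _))) (sumTo-+ (suc n) _ _)

  dconv-*ˡ : ∀ n a X Y → dconv (λ i → a * X i) Y n ≈ a * dconv X Y n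
  dconv-*ˡ n a X Y = trans (sumTo-cong (suc n) (λ i → solve 4 (λ c x y a → c :* ((a :* x) :* y) := a :* (c :* (x :* y))) refl _ _ _ a))
                           (sym (sumTo-*ˡ (suc n) a _))

  dconv-*ʳ : ∀ n a X Y → dconv X (λ i m → a * Y i m) n ≈ a * dconv X Y n
  dconv-*ʳ n a X Y = trans (sumTo-cong (suc n) (λ i → solve 4 (λ c x y a → c :* (x :* (a :* y)) := a :* (c :* (x :* y))) refl _ _ _ a))
                           (sym (sumTo-*ˡ (suc n) a _))

  ⋆-zeroʳ : ∀ n A B → (∀ m → B m ≈ 0#) → (A ⋆ B) n ≈ 0#
  ⋆-zeroʳ n A B zeroB = sumTo-zero (suc n) (λ i _ → trans (*-cong refl (trans (*-cong refl (zeroB _)) (zeroʳ _))) (zeroʳ _))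

  ⋆-identityʳ : ∀ n A → (A ⋆ 𝟙) n ≈ A n
  ⋆-identityʳ n A = begin
    sumTo n (λ i → ι (n C i) * (A i * 𝟙 (n ∸ i))) + ι (n C n) * (A n * 𝟙 (n ∸ n))
      ≈⟨ +-cong (sumTo-zero n (λ i i<n → trans (*-cong refl (*-cong refl (reflexive (P.cong 𝟙 (+-∸-assoc 1 i<n)))))
                                              (trans (*-cong refl (zeroʳ _)) (zeroʳ _))))
                (*-cong (reflexive (P.cong ι (nCn≡1 n))) (*-cong refl (reflexive (P.cong 𝟙 (n∸n≡0 n))))) ⟩
    0# + (1# + 0#) * (A n * 1#) ≈⟨ solve 1 (λ a → con 0 :+ (con 1 :+ con 0) :* (a :* con 1) := a) refl (A n) ⟩
    A n ∎

  dconv-∂ : ∀ n X Y → dconv X Y (suc n) ≈ dconv (∂ X) (λ i → Y (suc i)) n + dconv X (λ i → ∂ (Y i)) n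
  dconv-∂ n X Y = begin
    dconv X Y (suc n) ≈⟨ sumTo-peel (suc n) _ ⟩
    first + sumTo (suc n) (λ j → ι (suc n C suc j) * (X (suc j) * Y (suc j) (n ∸ j)))
      ≈⟨ +-cong refl (sumTo-cong (suc n) (λ j → trans (*-cong (ι-pascal n j) refl) (distribʳ _ _ _))) ⟩
    first + sumTo (suc n) (λ j → ι (n C j) * (X (suc j) * Y (suc j) (n ∸ j)) + ι (n C suc j) * (X (suc j) * Y (suc j) (n ∸ j)))
      ≈⟨ +-cong refl (sumTo-+ (suc n) _ _) ⟩
    first + (dconv (∂ X) (λ i → Y (suc i)) n + (rest + ι (n C suc n) * (X (suc n) * Y (suc n) (n ∸ n))))
      ≈⟨ +-cong refl (+-cong refl (+-cong refl (trans (*-cong (reflexive (P.cong ι (k>n⇒nCk≡0 {n} {suc n} ≤-refl))) refl) (zeroˡ _)))) ⟩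
    first + (dconv (∂ X) (λ i → Y (suc i)) n + (rest + 0#))
      ≈⟨ solve 3 (λ a b c → a :+ (b :+ (c :+ con 0)) := b :+ (a :+ c)) refl first _ rest ⟩
    dconv (∂ X) (λ i → Y (suc i)) n + (first + rest)
      ≈⟨ +-cong refl (+-cong refl (sumTo-cong< n (λ j j<n → *-cong refl (*-cong refl (reflexive (P.cong (Y (suc j)) (+-∸-assoc 1 j<n))))))) ⟩
    dconv (∂ X) (λ i → Y (suc i)) n + (first + sumTo n (λ j → ι (n C suc j) * (X (suc j) * Y (suc j) (suc (n ∸ suc j)))))
      ≈⟨ +-cong refl (sumTo-peel n _) ⟨
    dconv (∂ X) (λ i → Y (suc i)) n + dconv X (λ i → ∂ (Y i)) n ∎
    where
    first = ι (n C 0) * (X 0 * Y 0 (suc n))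
    rest  = sumTo n (λ j → ι (n C suc j) * (X (suc j) * Y (suc j) (n ∸ j)))

  ⋆-dconv : ∀ n A X Y → (A ⋆ dconv X Y) n ≈ dconv X (λ j → A ⋆ Y j) n
  ⋆-dconv zero A X Y =
    solve 3 (λ a b c → con 0 :+ (con 1 :+ con 0) :* (a :* (con 0 :+ (con 1 :+ con 0) :* (b :* c)))
                    := con 0 :+ (con 1 :+ con 0) :* (b :* (con 0 :+ (con 1 :+ con 0) :* (a :* c)))) refl (A 0) (X 0) (Y 0 0)
  ⋆-dconv (suc m) A X Y = begin
    (A ⋆ dconv X Y) (suc m) ≈⟨ dconv-∂ m A (λ _ → dconv X Y) ⟩
    (∂ A ⋆ dconv X Y) m + (A ⋆ ∂ (dconv X Y)) m ≈⟨ +-cong refl (⋆-congʳ m (λ k _ → dconv-∂ k X Y)) ⟩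
    (∂ A ⋆ dconv X Y) m + (A ⋆ (λ k → dconv (∂ X) (λ i → Y (suc i)) k + dconv X (λ i → ∂ (Y i)) k)) m
      ≈⟨ +-cong refl (dconv-+ʳ m A (λ _ → dconv (∂ X) (λ i → Y (suc i))) (λ _ → dconv X (λ i → ∂ (Y i)))) ⟩
    (∂ A ⋆ dconv X Y) m + ((A ⋆ dconv (∂ X) (λ i → Y (suc i))) m + (A ⋆ dconv X (λ i → ∂ (Y i))) m)
      ≈⟨ +-cong (⋆-dconv m (∂ A) X Y) (+-cong (⋆-dconv m A (∂ X) (λ i → Y (suc i))) (⋆-dconv m A X (λ i → ∂ (Y i)))) ⟩
    dconv X (λ j → ∂ A ⋆ Y j) m + (dconv (∂ X) (λ j → A ⋆ Y (suc j)) m + dconv X (λ j → A ⋆ ∂ (Y j)) m)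
      ≈⟨ solve 3 (λ a b c → a :+ (b :+ c) := b :+ (a :+ c)) refl _ _ _ ⟩
    dconv (∂ X) (λ j → A ⋆ Y (suc j)) m + (dconv X (λ j → ∂ A ⋆ Y j) m + dconv X (λ j → A ⋆ ∂ (Y j)) m)
      ≈⟨ +-cong refl (dconv-+ʳ m X (λ j → ∂ A ⋆ Y j) (λ j → A ⋆ ∂ (Y j))) ⟨
    dconv (∂ X) (λ j → A ⋆ Y (suc j)) m + dconv X (λ j k → (∂ A ⋆ Y j) k + (A ⋆ ∂ (Y j)) k) m
      ≈⟨ +-cong refl (dconv-congʳ m X (λ j → ∂ (A ⋆ Y j)) (λ j k → (∂ A ⋆ Y j) k + (A ⋆ ∂ (Y j)) k) (λ i _ → dconv-∂ (m ∸ i) A (λ _ → Y i))) ⟨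
    dconv (∂ X) (λ j → A ⋆ Y (suc j)) m + dconv X (λ j → ∂ (A ⋆ Y j)) m ≈⟨ dconv-∂ m X (λ j → A ⋆ Y j) ⟨
    dconv X (λ j → A ⋆ Y j) (suc m) ∎

  ⋆-comm : ∀ n A B → (A ⋆ B) n ≈ (B ⋆ A) n
  ⋆-comm zero    A B = +-cong refl (*-cong refl (*-comm _ _))
  ⋆-comm (suc m) A B = begin
    (A ⋆ B) (suc m) ≈⟨ dconv-∂ m A (λ _ → B) ⟩
    (∂ A ⋆ B) m + (A ⋆ ∂ B) m ≈⟨ +-cong (⋆-comm m (∂ A) B) (⋆-comm m A (∂ B)) ⟩
    (B ⋆ ∂ A) m + (∂ B ⋆ A) m ≈⟨ +-comm _ _ ⟩
    (∂ B ⋆ A) m + (B ⋆ ∂ A) m ≈⟨ dconv-∂ m B (λ _ → A) ⟨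
    (B ⋆ A) (suc m) ∎

  θ-Leibniz : ∀ n A B → ι n * (A ⋆ B) n ≈ (θ A ⋆ B) n + (A ⋆ θ B) n
  θ-Leibniz n A B = begin
    ι n * (A ⋆ B) n ≈⟨ sumTo-*ˡ (suc n) _ _ ⟩
    sumTo (suc n) (λ i → ι n * (ι (n C i) * (A i * B (n ∸ i))))
      ≈⟨ sumTo-cong< (suc n) (λ { i (s≤s i≤n) → trans (*-cong (ι-∸ i≤n) refl)
           (solve 5 (λ ii id c a b → (ii :+ id) :* (c :* (a :* b)) := c :* ((ii :* a) :* b) :+ c :* (a :* (id :* b))) refl (ι i) (ι (n ∸ i)) _ _ _) }) ⟩
    sumTo (suc n) (λ i → ι (n C i) * (θ A i * B (n ∸ i)) + ι (n C i) * (A i * θ B (n ∸ i))) ≈⟨ sumTo-+ (suc n) _ _ ⟩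
    (θ A ⋆ B) n + (A ⋆ θ B) n ∎

  prodTo-cong : ∀ m {f g : Seq} → (∀ i → f i ≈ g i) → prodTo m f ≈ prodTo m g
  prodTo-cong zero    eq = refl
  prodTo-cong (suc m) eq = *-cong (prodTo-cong m eq) (eq m)

  prodTo-peel : ∀ m (f : Seq) → prodTo (suc m) f ≈ f 0 * prodTo m (λ i → f (suc i))
  prodTo-peel zero    f = *-comm _ _
  prodTo-peel (suc m) f = trans (*-cong (prodTo-peel m f) refl) (*-assoc _ _ _)

  fallFact-cong : ∀ m {a b} → a ≈ b → fallFact a m ≈ fallFact b m
  fallFact-cong m a≈b = prodTo-cong m (λ i → +-cong a≈b refl)

  fallFact-peel : ∀ a m → fallFact a (suc m) ≈ a * fallFact (a - 1#) m
  fallFact-peel a m = trans (prodTo-peel m _)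
    (*-cong (trans (+-cong refl ε⁻¹≈ε) (+-identityʳ a))
            (prodTo-cong m (λ i → trans (+-cong refl (sym (⁻¹-∙-comm 1# (ι i)))) (sym (+-assoc _ _ _)))))

  -- Partial Bell polynomials.

  -- Column k of the Bell triangle as an EGF, namely (Σⱼ zⱼ tʲ/j!)ᵏ/k!.  The defining
  -- recurrence says that Bell z (n+1) (k+1) is definitionally (∂ z ⋆ Bcol z k) n.
  Bcol : Seq → ℕ → Seq
  Bcol z k n = Bell z n k

  Bell-𝟙 : ∀ z n → Bell z n 0 ≈ 𝟙 n
  Bell-𝟙 z zero    = refl
  Bell-𝟙 z (suc n) = refl

  -- B_{m,k} = 0 for m < k (the EGF of column k starts at tᵏ).
  Bell-vanish : ∀ z {m k} → m < k → Bell z m k ≈ 0#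
  Bell-vanish z {zero}  {suc k} _           = refl
  Bell-vanish z {suc m} {suc k} (s≤s m<k) = sumTo-zero (suc m) (λ i _ →
    trans (*-cong refl (trans (*-cong refl (Bell-vanish z (≤-trans (s≤s (m∸n≤m m i)) m<k))) (zeroʳ _))) (zeroʳ _))

  trim : Seq → Seq
  trim z zero    = 0#
  trim z (suc j) = z (suc j)

  -- Degree identity: (k+1) B_{n,k+1} = (z ⋆ B_{·,k})ₙ, i.e. (k+1)·f^{k+1}/(k+1)! = f · fᵏ/k!.
  Bell-degree : ∀ z k n → ι (suc k) * Bell z n (suc k) ≈ (trim z ⋆ Bcol z k) n
  Bell-degree z k zero =
    solve 2 (λ i b → i :* con 0 := con 0 :+ (con 1 :+ con 0) :* (con 0 :* b)) refl (ι (suc k)) (Bell z 0 k)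
  Bell-degree z zero (suc m) = begin
    ι 1 * (∂ z ⋆ Bcol z 0) m ≈⟨ solve 1 (λ a → (con 1 :+ con 0) :* a := a :+ con 0) refl _ ⟩
    (∂ z ⋆ Bcol z 0) m + 0# ≈⟨ +-cong refl (⋆-zeroʳ m (trim z) (∂ (Bcol z 0)) (λ _ → refl)) ⟨
    (∂ z ⋆ Bcol z 0) m + (trim z ⋆ ∂ (Bcol z 0)) m ≈⟨ dconv-∂ m (trim z) (λ _ → Bcol z 0) ⟨
    (trim z ⋆ Bcol z 0) (suc m) ∎
  Bell-degree z (suc k) (suc m) = begin
    ι (suc (suc k)) * (∂ z ⋆ Bcol z (suc k)) m ≈⟨ distribʳ _ _ _ ⟩
    1# * (∂ z ⋆ Bcol z (suc k)) m + ι (suc k) * (∂ z ⋆ Bcol z (suc k)) m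
      ≈⟨ +-cong (*-identityˡ _) (sym (dconv-*ʳ m _ (∂ z) (λ _ → Bcol z (suc k)))) ⟩
    (∂ z ⋆ Bcol z (suc k)) m + (∂ z ⋆ (λ j → ι (suc k) * Bell z j (suc k))) m
      ≈⟨ +-cong refl (⋆-congʳ m (λ j _ → Bell-degree z k j)) ⟩
    (∂ z ⋆ Bcol z (suc k)) m + (∂ z ⋆ (trim z ⋆ Bcol z k)) m ≈⟨ +-cong refl (⋆-dconv m (∂ z) (trim z) (λ _ → Bcol z k)) ⟩
    (∂ z ⋆ Bcol z (suc k)) m + (trim z ⋆ (∂ z ⋆ Bcol z k)) m ≈⟨ dconv-∂ m (trim z) (λ _ → Bcol z (suc k)) ⟨
    (trim z ⋆ Bcol z (suc k)) (suc m) ∎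

  -- Weight identity: n B_{n,k+1} = (θz ⋆ B_{·,k})ₙ, obtained by applying θ = t·d/dt.
  Bell-weight : ∀ z k n → ι n * Bell z n (suc k) ≈ (θ (trim z) ⋆ Bcol z k) n
  Bell-weight z k zero =
    solve 1 (λ b → con 0 :* con 0 := con 0 :+ (con 1 :+ con 0) :* ((con 0 :* con 0) :* b)) refl (Bell z 0 k)
  Bell-weight z k (suc m) = begin
    (1# + ι m) * (∂ z ⋆ Bcol z k) m ≈⟨ distribʳ _ _ _ ⟩
    1# * (∂ z ⋆ Bcol z k) m + ι m * (∂ z ⋆ Bcol z k) m ≈⟨ +-cong (*-identityˡ _) (θ-Leibniz m (∂ z) (Bcol z k)) ⟩
    (∂ z ⋆ Bcol z k) m + ((θ (∂ z) ⋆ Bcol z k) m + (∂ z ⋆ θ (Bcol z k)) m) ≈⟨ +-assoc _ _ _ ⟨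
    ((∂ z ⋆ Bcol z k) m + (θ (∂ z) ⋆ Bcol z k) m) + (∂ z ⋆ θ (Bcol z k)) m
      ≈⟨ +-cong (sym (dconv-+ˡ m (∂ z) (θ (∂ z)) (λ _ → Bcol z k))) (θ-column k) ⟩
    ((λ i → ∂ z i + θ (∂ z) i) ⋆ Bcol z k) m + (θ (trim z) ⋆ ∂ (Bcol z k)) m
      ≈⟨ +-cong (⋆-congˡ m {B = Bcol z k} (λ i _ → trans (+-cong (sym (*-identityˡ _)) refl) (sym (distribʳ _ _ _)))) refl ⟩
    (∂ (θ (trim z)) ⋆ Bcol z k) m + (θ (trim z) ⋆ ∂ (Bcol z k)) m ≈⟨ dconv-∂ m (θ (trim z)) (λ _ → Bcol z k) ⟨
    (θ (trim z) ⋆ Bcol z k) (suc m) ∎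
    where
    θ-column₀ : ∀ j → θ (Bcol z 0) j ≈ 0#
    θ-column₀ zero    = zeroˡ _
    θ-column₀ (suc j) = zeroʳ _
    θ-column : ∀ j → (∂ z ⋆ θ (Bcol z j)) m ≈ (θ (trim z) ⋆ ∂ (Bcol z j)) m
    θ-column zero    = trans (⋆-zeroʳ m (∂ z) _ θ-column₀) (sym (⋆-zeroʳ m _ _ (λ _ → refl)))
    θ-column (suc j) = trans (⋆-congʳ m (λ i _ → Bell-weight z j i)) (⋆-dconv m (∂ z) (θ (trim z)) (λ _ → Bcol z j))

  Bell-affine : ∀ a b z k n →
    (a * ι n + b * ι (suc k)) * Bell z n (suc k) ≈ ((λ j → (a * ι j + b) * trim z j) ⋆ Bcol z k) n
  Bell-affine a b z k n = sym (begin
    ((λ j → (a * ι j + b) * trim z j) ⋆ Bcol z k) n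
      ≈⟨ ⋆-congˡ n {B = Bcol z k} (λ j _ → solve 4 (λ a b i y → (a :* i :+ b) :* y := a :* (i :* y) :+ b :* y) refl a b (ι j) (trim z j)) ⟩
    ((λ j → a * θ (trim z) j + b * trim z j) ⋆ Bcol z k) n ≈⟨ dconv-+ˡ n _ _ (λ _ → Bcol z k) ⟩
    ((λ j → a * θ (trim z) j) ⋆ Bcol z k) n + ((λ j → b * trim z j) ⋆ Bcol z k) n
      ≈⟨ +-cong (dconv-*ˡ n a (θ (trim z)) (λ _ → Bcol z k)) (dconv-*ˡ n b (trim z) (λ _ → Bcol z k)) ⟩
    a * (θ (trim z) ⋆ Bcol z k) n + b * (trim z ⋆ Bcol z k) n ≈⟨ +-cong (*-cong refl (Bell-weight z k n)) (*-cong refl (Bell-degree z k n)) ⟨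
    a * (ι n * Bell z n (suc k)) + b * (ι (suc k) * Bell z n (suc k))
      ≈⟨ solve 5 (λ a b i j y → a :* (i :* y) :+ b :* (j :* y) := (a :* i :+ b :* j) :* y) refl a b (ι n) (ι (suc k)) (Bell z n (suc k)) ⟩
    (a * ι n + b * ι (suc k)) * Bell z n (suc k) ∎)

  module Family (α β : Carrier) (x : Seq) where

    w : ℕ → Carrier
    w j = α * ι j + β

    ω : Seq
    ω j = w j * trim x j

    ψ : Carrier → Seq
    ψ c n = sumTo (suc n) (λ k → fallFact (c + α * ι n + β * ι k) k * Bell x n k)

    q : Carrier → Seq
    q c n = sumTo n (λ j → fallFact (α * ι n + β * ι (suc j) - 1# + c) j * Bell x n (suc j))

    g : Carrier → Seq
    g c n = 𝟙 n + c * q c n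

    -- T_c = Σᵢ xᵢ₊₁ tⁱ/i! · ψ_{c−1+w(i+1)}, which is the derivative of q_c.
    T : Carrier → Seq
    T c = dconv (∂ x) (λ i → ψ (c - 1# + w (suc i)))

    ψ-cong : ∀ n {c c'} → c ≈ c' → ψ c n ≈ ψ c' n
    ψ-cong n c≈c' = sumTo-cong (suc n) (λ k → *-cong (fallFact-cong k (+-cong (+-cong c≈c' refl) refl)) refl)

    T-cong : ∀ n {c c'} → c ≈ c' → T c n ≈ T c' n
    T-cong n {c} {c'} c≈c' = dconv-congʳ n (∂ x) (λ i → ψ (c - 1# + w (suc i))) (λ i → ψ (c' - 1# + w (suc i)))
      (λ i _ → ψ-cong (n ∸ i) (+-cong (+-cong c≈c' refl) refl))

    q-derivative : ∀ c n → q c (suc n) ≈ T c n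
    q-derivative c n = begin
      q c (suc n) ≈⟨ sumTo-swap-weighted (suc n) (suc n) E (λ i → ι (n C i)) (∂ x) (λ i j → Bell x (n ∸ i) j) ⟩
      sumTo (suc n) (λ i → ι (n C i) * (∂ x i * sumTo (suc n) (λ j → E j * Bell x (n ∸ i) j)))
        ≈⟨ sumTo-cong< (suc n) (λ { i (s≤s i≤n) → *-cong refl (*-cong refl (inner i i≤n)) }) ⟩
      T c n ∎
      where
      E : Seq
      E j = fallFact (α * ι (suc n) + β * ι (suc j) - 1# + c) j
      reindex : ∀ ii id ij → α * (1# + (ii + id)) + β * (1# + ij) - 1# + c ≈ (c - 1# + (α * (1# + ii) + β)) + α * id + β * ij
      reindex = solve 7 (λ a b c m1 ii id ij → a :* (con 1 :+ (ii :+ id)) :+ b :* (con 1 :+ ij) :+ m1 :+ c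
                                              := (c :+ m1 :+ (a :* (con 1 :+ ii) :+ b)) :+ a :* id :+ b :* ij) refl α β c (- 1#)
      inner : ∀ i → i ≤ n → sumTo (suc n) (λ j → E j * Bell x (n ∸ i) j) ≈ ψ (c - 1# + w (suc i)) (n ∸ i)
      inner i i≤n = begin
        sumTo (suc n) (λ j → E j * Bell x (n ∸ i) j)
          ≈⟨ sumTo-truncate (suc n) (suc (n ∸ i)) (s≤s (m∸n≤m n i)) (λ j p _ → trans (*-cong refl (Bell-vanish x p)) (zeroʳ _)) ⟩
        sumTo (suc (n ∸ i)) (λ j → E j * Bell x (n ∸ i) j)
          ≈⟨ sumTo-cong (suc (n ∸ i)) (λ j → *-cong (fallFact-cong j
               (trans (+-cong (+-cong (+-cong (*-cong refl (+-cong refl (ι-∸ i≤n))) refl) refl) refl) (reindex (ι i) (ι (n ∸ i)) (ι j)))) refl) ⟩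
        ψ (c - 1# + w (suc i)) (n ∸ i) ∎

    ω₀-absorbs : ∀ u v → ω 0 * u ≈ ω 0 * v
    ω₀-absorbs u v = trans (*-cong (zeroʳ _) refl) (trans (zeroˡ u) (sym (trans (*-cong (zeroʳ _) refl) (zeroˡ v))))

    -- Splitting off the k = 0 term of ψ_c and applying Bell-affine to the rest:
    -- ψ_c = g_c + Σⱼ ωⱼ tʲ/j! · ψ_{c−1+wⱼ}.
    ψ-split : ∀ c n → ψ c n ≈ g c n + dconv ω (λ j → ψ (c - 1# + w j)) n
    ψ-split c n = begin
      ψ c n ≈⟨ sumTo-peel n _ ⟩
      1# * Bell x n 0 + sumTo n (λ j → fallFact (a j) (suc j) * Bell x n (suc j))
        ≈⟨ +-cong (trans (*-identityˡ _) (Bell-𝟙 x n)) (sumTo-cong n peel) ⟩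
      𝟙 n + sumTo n (λ j → c * (E j * Bell x n (suc j)) + E j * ((α * ι n + β * ι (suc j)) * Bell x n (suc j)))
        ≈⟨ +-cong refl (trans (sumTo-+ n _ _) (+-cong (sym (sumTo-*ˡ n c _)) (sumTo-cong n (λ j → *-cong refl (Bell-affine α β x j n))))) ⟩
      𝟙 n + (c * q c n + sumTo n (λ j → E j * (ω ⋆ Bcol x j) n))
        ≈⟨ +-cong refl (+-cong refl (sumTo-swap-weighted n (suc n) E (λ i → ι (n C i)) ω (λ i j → Bell x (n ∸ i) j))) ⟩
      𝟙 n + (c * q c n + sumTo (suc n) (λ i → ι (n C i) * (ω i * sumTo n (λ j → E j * Bell x (n ∸ i) j))))
        ≈⟨ +-cong refl (+-cong refl (sumTo-cong< (suc n) (λ { i (s≤s i≤n) → *-cong refl (inner i i≤n) }))) ⟩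
      𝟙 n + (c * q c n + dconv ω (λ j → ψ (c - 1# + w j)) n) ≈⟨ +-assoc _ _ _ ⟨
      g c n + dconv ω (λ j → ψ (c - 1# + w j)) n ∎
      where
      a E : ℕ → Carrier
      a j = c + α * ι n + β * ι (suc j)
      E j = fallFact (α * ι n + β * ι (suc j) - 1# + c) j
      -- (a_j)↓(j+1) = a_j · E_j, and a_j = c + (αn + β(j+1))
      peel : ∀ j → fallFact (a j) (suc j) * Bell x n (suc j)
                   ≈ c * (E j * Bell x n (suc j)) + E j * ((α * ι n + β * ι (suc j)) * Bell x n (suc j))
      peel j = trans (*-cong (trans (fallFact-peel (a j) j) (*-cong refl (fallFact-cong j
                 (solve 4 (λ c an bj m1 → c :+ an :+ bj :+ m1 := an :+ bj :+ m1 :+ c) refl c (α * ι n) (β * ι (suc j)) (- 1#))))) refl)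
               (solve 5 (λ c an bj e b → ((c :+ an :+ bj) :* e) :* b := c :* (e :* b) :+ e :* ((an :+ bj) :* b))
                        refl c (α * ι n) (β * ι (suc j)) (E j) (Bell x n (suc j)))
      reindex : ∀ ii id ij → α * (ii + id) + β * (1# + ij) - 1# + c ≈ (c - 1# + (α * ii + β)) + α * id + β * ij
      reindex = solve 7 (λ a b c m1 ii id ij → a :* (ii :+ id) :+ b :* (con 1 :+ ij) :+ m1 :+ c
                                              := (c :+ m1 :+ (a :* ii :+ b)) :+ a :* id :+ b :* ij) refl α β c (- 1#)
      inner : ∀ i → i ≤ n → ω i * sumTo n (λ j → E j * Bell x (n ∸ i) j) ≈ ω i * ψ (c - 1# + w i) (n ∸ i)
      inner zero    _    = ω₀-absorbs _ _
      inner (suc i) i<n = *-cong refl (begin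
        sumTo n (λ j → E j * Bell x (n ∸ suc i) j)
          ≈⟨ sumTo-truncate n (suc (n ∸ suc i)) (∸-suc< i<n) (λ j p _ → trans (*-cong refl (Bell-vanish x p)) (zeroʳ _)) ⟩
        sumTo (suc (n ∸ suc i)) (λ j → E j * Bell x (n ∸ suc i) j)
          ≈⟨ sumTo-cong (suc (n ∸ suc i)) (λ j → *-cong (fallFact-cong j
               (trans (+-cong (+-cong (+-cong (*-cong refl (ι-∸ i<n)) refl) refl) refl) (reindex (ι (suc i)) (ι (n ∸ suc i)) (ι j)))) refl) ⟩
        ψ (c - 1# + w (suc i)) (n ∸ suc i) ∎)

    GLaw ΨLaw : ℕ → Set (c ⊔ ℓ)
    GLaw n = ∀ a b → (g a ⋆ g b) n ≈ g (a + b) n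
    ΨLaw n = ∀ a b → (g a ⋆ ψ b) n ≈ ψ (a + b) n

    g-derivative : ∀ c n → g c (suc n) ≈ c * T c n
    g-derivative c n = trans (+-identityˡ _) (*-cong refl (q-derivative c n))

    T-law : ∀ n → (∀ {m} → m ≤ n → ΨLaw m) → ∀ a b → (g b ⋆ T a) n ≈ T (a + b) n
    T-law n ψ-laws a b = trans (⋆-dconv n (g b) (∂ x) (λ i → ψ (a - 1# + w (suc i))))
      (dconv-congʳ n (∂ x) (λ i → g b ⋆ ψ (a - 1# + w (suc i))) (λ i → ψ (a + b - 1# + w (suc i)))
        (λ i _ → trans (ψ-laws (m∸n≤m n i) b (a - 1# + w (suc i)))
          (ψ-cong (n ∸ i) (solve 4 (λ a b m1 W → b :+ (a :+ m1 :+ W) := a :+ b :+ m1 :+ W) refl a b (- 1#) (w (suc i))))))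

    -- The g-law at order n follows from the ψ-law below n: by the Leibniz rule
    -- (g_a ⋆ g_b)' = a T_a ⋆ g_b + g_a ⋆ b T_b = (a + b) T_{a+b}.
    g-law : ∀ n → (∀ {m} → m < n → ΨLaw m) → GLaw n
    g-law zero    _      a b =
      solve 3 (λ a b c → con 0 :+ (con 1 :+ con 0) :* ((con 1 :+ a :* con 0) :* (con 1 :+ b :* con 0)) := con 1 :+ c :* con 0) refl a b (a + b)
    g-law (suc n) ψ-laws a b = begin
      (g a ⋆ g b) (suc n) ≈⟨ dconv-∂ n (g a) (λ _ → g b) ⟩
      (∂ (g a) ⋆ g b) n + (g a ⋆ ∂ (g b)) n
        ≈⟨ +-cong (⋆-congˡ n {B = g b} (λ m _ → g-derivative a m)) (⋆-congʳ n (λ m _ → g-derivative b m)) ⟩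
      ((λ m → a * T a m) ⋆ g b) n + (g a ⋆ (λ m → b * T b m)) n
        ≈⟨ +-cong (dconv-*ˡ n a (T a) (λ _ → g b)) (dconv-*ʳ n b (g a) (λ _ → T b)) ⟩
      a * (T a ⋆ g b) n + b * (g a ⋆ T b) n ≈⟨ +-cong (*-cong refl (⋆-comm n (T a) (g b))) refl ⟩
      a * (g b ⋆ T a) n + b * (g a ⋆ T b) n
        ≈⟨ +-cong (*-cong refl (T-law n ψ-laws′ a b)) (*-cong refl (trans (T-law n ψ-laws′ b a) (T-cong n (+-comm b a)))) ⟩
      a * T (a + b) n + b * T (a + b) n ≈⟨ distribʳ _ _ _ ⟨
      (a + b) * T (a + b) n ≈⟨ g-derivative (a + b) n ⟨
      g (a + b) (suc n) ∎
      where
      ψ-laws′ : ∀ {m} → m ≤ n → ΨLaw m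
      ψ-laws′ m≤n = ψ-laws (s≤s m≤n)

    -- The ψ-law at order n follows from the g-law at n and the ψ-law below n, via ψ-split.
    ψ-law : ∀ n → GLaw n → (∀ {m} → m < n → ΨLaw m) → ΨLaw n
    ψ-law n g-law-n ψ-laws a b = begin
      (g a ⋆ ψ b) n ≈⟨ ⋆-congʳ n (λ m _ → ψ-split b m) ⟩
      (g a ⋆ (λ m → g b m + dconv ω (λ j → ψ (b - 1# + w j)) m)) n
        ≈⟨ dconv-+ʳ n (g a) (λ _ → g b) (λ _ → dconv ω (λ j → ψ (b - 1# + w j))) ⟩
      (g a ⋆ g b) n + (g a ⋆ dconv ω (λ j → ψ (b - 1# + w j))) n
        ≈⟨ +-cong (g-law-n a b) (⋆-dconv n (g a) ω (λ j → ψ (b - 1# + w j))) ⟩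
      g (a + b) n + dconv ω (λ j → g a ⋆ ψ (b - 1# + w j)) n
        ≈⟨ +-cong refl (dconv-cong n ω ω (λ j → g a ⋆ ψ (b - 1# + w j)) (λ j → ψ (a + b - 1# + w j)) inner) ⟩
      g (a + b) n + dconv ω (λ j → ψ (a + b - 1# + w j)) n ≈⟨ ψ-split (a + b) n ⟨
      ψ (a + b) n ∎
      where
      inner : ∀ i → i ≤ n → ω i * (g a ⋆ ψ (b - 1# + w i)) (n ∸ i) ≈ ω i * ψ (a + b - 1# + w i) (n ∸ i)
      inner zero    _   = ω₀-absorbs _ _
      inner (suc i) i<n = *-cong refl (trans (ψ-laws (∸-suc< i<n) a (b - 1# + w (suc i)))
        (ψ-cong (n ∸ suc i) (solve 4 (λ a b m1 W → a :+ (b :+ m1 :+ W) := a :+ b :+ m1 :+ W) refl a b (- 1#) (w (suc i)))))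

    exponential-law : ∀ n → GLaw n × ΨLaw n
    exponential-law = <-rec (λ n → GLaw n × ΨLaw n) step
      where
      step : ∀ n → (∀ {m} → m < n → GLaw m × ΨLaw m) → GLaw n × ΨLaw n
      step n below = g-law-n , ψ-law n g-law-n ψ-laws
        where
        ψ-laws : ∀ {m} → m < n → ΨLaw m
        ψ-laws m<n = proj₂ (below m<n)
        g-law-n : GLaw n
        g-law-n = g-law n ψ-laws

    -- The differential equation q_λ' = T_0 (1 + λ q_λ), from T_λ = g_λ ⋆ T_0.
    q-recurrence : ∀ l n → q l (suc n) ≈ T 0# n + l * (T 0# ⋆ q l) n
    q-recurrence l n = begin
      q l (suc n) ≈⟨ q-derivative l n ⟩
      T l n ≈⟨ T-cong n (+-identityˡ l) ⟨
      T (0# + l) n ≈⟨ T-law n (λ {m} _ → proj₂ (exponential-law m)) 0# l ⟨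
      (g l ⋆ T 0#) n ≈⟨ ⋆-comm n (g l) (T 0#) ⟩
      (T 0# ⋆ g l) n ≈⟨ dconv-+ʳ n (T 0#) (λ _ → 𝟙) (λ _ m → l * q l m) ⟩
      (T 0# ⋆ 𝟙) n + (T 0# ⋆ (λ m → l * q l m)) n ≈⟨ +-cong (⋆-identityʳ n (T 0#)) (dconv-*ʳ n l (T 0#) (λ _ → q l)) ⟩
      T 0# n + l * (T 0# ⋆ q l) n ∎

  -- The left-hand side: L_y(n) = Σ_{k=1}^n λ^{k−1} B_{n,k}(y), the EGF of (e^{λY} − 1)/λ.
  bellSum : Carrier → Seq → Seq
  bellSum l y n = sumTo n (λ j → pow l j * Bell y n (suc j))

  bellSum-recurrence : ∀ l y n → bellSum l y (suc n) ≈ ∂ y n + l * (∂ y ⋆ bellSum l y) n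
  bellSum-recurrence l y n = begin
    bellSum l y (suc n) ≈⟨ sumTo-peel n _ ⟩
    1# * (∂ y ⋆ Bcol y 0) n + sumTo n (λ j → (pow l j * l) * (∂ y ⋆ Bcol y (suc j)) n)
      ≈⟨ +-cong (trans (*-identityˡ _) (trans (⋆-congʳ n (λ m _ → Bell-𝟙 y m)) (⋆-identityʳ n (∂ y))))
                (sumTo-cong n (λ j → solve 3 (λ p l c → (p :* l) :* c := l :* (p :* c)) refl (pow l j) l _)) ⟩
    ∂ y n + sumTo n (λ j → l * (pow l j * (∂ y ⋆ Bcol y (suc j)) n)) ≈⟨ +-cong refl (sumTo-*ˡ n l _) ⟨
    ∂ y n + l * sumTo n (λ j → pow l j * (∂ y ⋆ Bcol y (suc j)) n)
      ≈⟨ +-cong refl (*-cong refl (sumTo-swap-weighted n (suc n) (pow l) (λ i → ι (n C i)) (∂ y) (λ i j → Bell y (n ∸ i) (suc j)))) ⟩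
    ∂ y n + l * sumTo (suc n) (λ i → ι (n C i) * (∂ y i * sumTo n (λ j → pow l j * Bell y (n ∸ i) (suc j))))
      ≈⟨ +-cong refl (*-cong refl (sumTo-cong< (suc n) (λ { i (s≤s i≤n) → *-cong refl (*-cong refl (truncated i≤n)) }))) ⟩
    ∂ y n + l * (∂ y ⋆ bellSum l y) n ∎
    where
    truncated : ∀ {i} → i ≤ n → sumTo n (λ j → pow l j * Bell y (n ∸ i) (suc j)) ≈ bellSum l y (n ∸ i)
    truncated {i} i≤n = sumTo-truncate n (n ∸ i) (m∸n≤m n i) (λ j p _ → trans (*-cong refl (Bell-vanish y (s≤s p))) (zeroʳ _))

  recurrence-unique : ∀ {l} {a b f h : Seq} → f 0 ≈ h 0 →
    (∀ n → f (suc n) ≈ a n + l * (b ⋆ f) n) → (∀ n → h (suc n) ≈ a n + l * (b ⋆ h) n) → ∀ n → f n ≈ h n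
  recurrence-unique {l} {a} {b} {f} {h} f₀≈h₀ f-rec h-rec = <-rec (λ n → f n ≈ h n) step
    where
    step : ∀ n → (∀ {m} → m < n → f m ≈ h m) → f n ≈ h n
    step zero    _     = f₀≈h₀
    step (suc n) below = begin
      f (suc n) ≈⟨ f-rec n ⟩
      a n + l * (b ⋆ f) n ≈⟨ +-cong refl (*-cong refl (⋆-congʳ n (λ m m≤n → below (s≤s m≤n)))) ⟩
      a n + l * (b ⋆ h) n ≈⟨ h-rec n ⟨
      h (suc n) ∎

  -- Both sides of the theorem solve L' = y' (1 + λ L) with L(0) = 0, where y = q_0.
  bellSum-yseq : ∀ α β x l n → bellSum l (yseq α β x) n ≈ Family.q α β x l n
  bellSum-yseq α β x l = recurrence-unique refl L-recurrence (q-recurrence l)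
    where
    open Family α β x
    y : Seq
    y = yseq α β x
    y′≈T₀ : ∀ n → ∂ y n ≈ T 0# n
    y′≈T₀ n = trans (sumTo-cong (suc n) (λ j → *-cong (fallFact-cong j (sym (+-identityʳ _))) refl)) (q-derivative 0# n)
    L-recurrence : ∀ n → bellSum l y (suc n) ≈ T 0# n + l * (T 0# ⋆ bellSum l y) n
    L-recurrence n = trans (bellSum-recurrence l y n) (+-cong (y′≈T₀ n) (*-cong refl (⋆-congˡ n {B = bellSum l y} (λ m _ → y′≈T₀ m))))

proposition8p4 : {c ℓ : Level} (R : CommutativeRing c ℓ) →
    let open CommutativeRing R
        open BellDefs R
    in (α β : Carrier) (x : ℕ → Carrier) (n : ℕ) → 1 ≤ n → (λ' : Carrier) →
       sumTo n (λ j → pow λ' j * Bell (yseq α β x) n (suc j))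
         ≈ sumTo n (λ j → fallFact (α * ι n + β * ι (suc j) - 1# + λ') j * Bell x n (suc j))
proposition8p4 R α β x n _ λ' = BellIdentity.bellSum-yseq R α β x λ' n
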